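{- Let $\mathcal{C}=\langle\ell_0,\ell_1,\ell_2\rangle$ be a caterpillar ladder together with a map $\phi$ satisfying (P1), (P2) and (P3$^\downarrow$) with respect to a tree-child network $\mathcal{N}$ on $X$ (a loose caterpillar ladder $\mathcal{C}_2^\downarrow$ of $\mathcal{N}$); write $e_j=(\phi(p_j),\phi(v_j))$ and $f_j=(\phi(q_j),\phi(v_j))$ for $j=1,2$. Suppose $f_2$ is non-essential in $\mathcal{N}$. If $\mathcal{E}$ and $\mathcal{E}'$ are two embeddings of the same phylogenetic $X$-tree $\mathcal{T}$ in $\mathcal{N}$ such that $\mathcal{E}'$ uses $\{f_1,f_2\}$ and $\mathcal{E}$ uses $e_2$, then $\mathcal{E}$ also uses $e_1$.
   Context: A (rooted binary) phylogenetic network on a finite nonempty set $X$ is a rooted acyclic directed graph with no parallel arcs such that the root has in-degree 0 and out-degree 2; the leaves (out-degree 0) have in-degree 1 and are exactly the elements of $X$; every other vertex is a tree vertex (in-degree 1, out-degree 2) or a reticulation (in-degree 2, out-degree 1). A tree path is a directed path $v_1,\dots,v_n$ ($n\ge1$) with each of $v_2,\dots,v_n$ a tree vertex or a leaf. The network is tree-child if every non-leaf vertex has a child that is a tree vertex or a leaf. A phylogenetic $X$-tree is a phylogenetic network on $X$ with no reticulations. An embedding of a phylogenetic tree $\mathcal{T}$ in $\mathcal{N}$ is a set of arcs inducing a subdivision of $\mathcal{T}$; it uses the arcs it contains; $\mathcal{N}$ displays $\mathcal{T}$ if an embedding exists. An arc $e$ is essential if some phylogenetic $X$-tree displayed by $\mathcal{N}$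 has every embedding in $\mathcal{N}$ using $e$; otherwise non-essential. The caterpillar ladder $\langle\ell_0,\ell_1,\ell_2\rangle$ (distinct labels) has vertices $\ell_0,\ell_1,\ell_2,v_1,v_2,p_1,p_2,q_1,q_2$ and arcs of the directed path $q_2,q_1,p_2,p_1,\ell_0$ together with $(p_j,v_j),(q_j,v_j),(v_j,\ell_j)$ for $j=1,2$; its spine is the path $q_2,q_1,p_2,p_1$. With $\{\ell_0,\ell_1,\ell_2\}\subseteq X$ and $\phi$ an injective map from its vertices to those of $\mathcal{N}$ with $\phi(\ell_j)=\ell_j$, the conditions are: (P1) there are tree paths in $\mathcal{N}$ from $\phi(p_1)$ to $\ell_0$ and from $\phi(v_j)$ to $\ell_j$ ($j=1,2$); (P2) $(\phi(p_j),\phi(v_j))$ and $(\phi(q_j),\phi(v_j))$ are arcs of $\mathcal{N}$; (P3$^\downarrow$) for each spine arc $(u,w)\ne(p_2,p_1)$ there is a tree path from $\phi(u)$ to $\phi(w)$, and there is a directed path from $\phi(p_2)$ to $\phi(p_1)$ in $\mathcal{N}$. -}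

module Defs where

open import Data.Nat using (ℕ; zero; suc)
open import Data.Fin using (Fin)
open import Data.Bool using (Bool; true; false; if_then_else_)
open import Data.List using (List; []; _∷_; _++_; [_]; map; allFin)
open import Data.Nat.ListAction using (sum)
open import Data.List.Relation.Unary.All using (All)
open import Data.List.Relation.Unary.Linked using (Linked)
open import Data.List.Membership.Propositional using (_∈_)
open import Data.Product using (Σ; ∃; ∃₂; _×_; _,_)
open import Data.Sum using (_⊎_)
open import Relation.Binary.PropositionalEquality using (_≡_; _≢_)
open import Relation.Nullary using (¬_)
open import Function.Definitions using (Injective)

count : ∀ {n} → (Fin n → Bool) → ℕ
count {n} f = sum (map (λ i → if f i then 1 else 0) (allFin n))

lastFrom : ∀ {A : Set} → A → List A → A
lastFrom u []       = u
lastFrom u (w ∷ ws) = lastFrom w ws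

Consec : ∀ {A : Set} → A → A → List A → Set
Consec u v xs = ∃₂ λ ys zs → xs ≡ ys ++ (u ∷ v ∷ zs)

-- Rooted binary phylogenetic networks on X = Fin k.
-- Vertices are Fin n; arcs are given by a Boolean adjacency relation
-- (so there are no parallel arcs by construction).

record Digraph : Set where
  field
    n   : ℕ
    arc : Fin n → Fin n → Bool

  V : Set
  V = Fin n

  _⟶_ : V → V → Set
  u ⟶ v = arc u v ≡ true

  indeg : V → ℕ
  indeg v = count (λ u → arc u v)

  outdeg : V → ℕ
  outdeg u = count (λ v → arc u v)

  isLeafV : V → Set
  isLeafV v = indeg v ≡ 1 × outdeg v ≡ 0

  isTreeV : V → Set
  isTreeV v = indeg v ≡ 1 × outdeg v ≡ 2

  isRet : V → Set
  isRet v = indeg v ≡ 2 × outdeg v ≡ 1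

  -- directed path v₁,…,vₘ (m ≥ 1) from u to v, given by the list
  -- v₂,…,vₘ of the vertices after the first one
  IsDPath : V → List V → V → Set
  IsDPath u vs v = Linked _⟶_ (u ∷ vs) × lastFrom u vs ≡ v

  DPath : V → V → Set
  DPath u v = Σ (List V) λ vs → IsDPath u vs v

  TreePath : V → V → Set
  TreePath u v = Σ (List V) λ vs →
    IsDPath u vs v × All (λ w → isTreeV w ⊎ isLeafV w) vs

  Acyclic : Set
  Acyclic = ∀ v (w : V) (ws : List V) → ¬ IsDPath v (w ∷ ws) v

record Network (k : ℕ) : Set where
  field
    graph : Digraph
  open Digraph graph public
  field
    root      : V
    leaf      : Fin k → V
    acyclic   : Acyclic
    root-deg  : indeg root ≡ 0 × outdeg root ≡ 2
    leaf-inj  : Injective _≡_ _≡_ leaf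
    leaf-deg  : ∀ x → isLeafV (leaf x)
    leaves-X  : ∀ v → outdeg v ≡ 0 → ∃ λ x → leaf x ≡ v
    other-deg : ∀ v → v ≢ root → isLeafV v ⊎ isTreeV v ⊎ isRet v

module _ {k : ℕ} where
  open Network

  TreeChild : Network k → Set
  TreeChild N = ∀ v → outdeg N v ≢ 0 →
    ∃ λ c → _⟶_ N v c × (isTreeV N c ⊎ isLeafV N c)

  IsPhyloTree : Network k → Set
  IsPhyloTree T = ∀ v → ¬ isRet T v

  ArcSet : Network k → Set
  ArcSet N = V N → V N → Bool

  -- E induces a subdivision of T (leaf labels preserved): T's vertices
  -- map injectively to N (ψ), each arc (a,b) of T is replaced by a
  -- directed path ψ a, route a b, ψ b whose arcs lie in E; interior
  -- vertices are not images of ψ and interiors of distinct arcs are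
  -- disjoint; and E consists exactly of the arcs of these paths.
  record Embedding (T N : Network k) (E : ArcSet N) : Set where
    field
      E⊆N    : ∀ u v → E u v ≡ true → _⟶_ N u v
      ψ      : V T → V N
      ψ-inj  : Injective _≡_ _≡_ ψ
      ψ-leaf : ∀ x → ψ (leaf T x) ≡ leaf N x
      route  : V T → V T → List (V N)
    full : V T → V T → List (V N)
    full a b = ψ a ∷ (route a b ++ [ ψ b ])
    field
      route-path  : ∀ a b → _⟶_ T a b →
                    Linked (λ u v → E u v ≡ true) (full a b)
      route-fresh : ∀ a b c w → _⟶_ T a b → w ∈ route a b → w ≢ ψ c
      route-disj  : ∀ a b a′ b′ w → _⟶_ T a b → _⟶_ T a′ b′ →
                    w ∈ route a b → w ∈ route a′ b′ → a ≡ a′ × b ≡ b′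
      E-covered   : ∀ u v → E u v ≡ true →
                    ∃₂ λ a b → _⟶_ T a b × Consec u v (full a b)

  Uses : {N : Network k} → ArcSet N → V N → V N → Set
  Uses E u v = E u v ≡ true

  Displays : Network k → Network k → Set
  Displays N T = Σ (ArcSet N) (Embedding T N)

  Essential : (N : Network k) → V N → V N → Set
  Essential N u v = ∃ λ (T : Network k) → IsPhyloTree T × Displays N T ×
    (∀ (E : ArcSet N) → Embedding T N E → Uses {N} E u v)

data CLVertex : Set where
  cℓ₀ cℓ₁ cℓ₂ v₁ v₂ p₁ p₂ q₁ q₂ : CLVertex

record LooseLadder {k : ℕ} (N : Network k) (ℓ₀ ℓ₁ ℓ₂ : Fin k)
                   (φ : CLVertex → Network.V N) : Set where
  open Network N
  field
    distinct₀₁ : ℓ₀ ≢ ℓ₁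
    distinct₀₂ : ℓ₀ ≢ ℓ₂
    distinct₁₂ : ℓ₁ ≢ ℓ₂
    φ-inj  : Injective _≡_ _≡_ φ
    φ-ℓ₀   : φ cℓ₀ ≡ leaf ℓ₀
    φ-ℓ₁   : φ cℓ₁ ≡ leaf ℓ₁
    φ-ℓ₂   : φ cℓ₂ ≡ leaf ℓ₂
    P1-0   : TreePath (φ p₁) (leaf ℓ₀)
    P1-1   : TreePath (φ v₁) (leaf ℓ₁)
    P1-2   : TreePath (φ v₂) (leaf ℓ₂)
    P2-e₁  : φ p₁ ⟶ φ v₁
    P2-e₂  : φ p₂ ⟶ φ v₂
    P2-f₁  : φ q₁ ⟶ φ v₁
    P2-f₂  : φ q₂ ⟶ φ v₂
    P3-q₂q₁ : TreePath (φ q₂) (φ q₁)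
    P3-q₁p₂ : TreePath (φ q₁) (φ p₂)
    P3-p₂p₁ : DPath (φ p₂) (φ p₁)

-- Suppose E avoids e₁. The leaf ℓ₁ hangs below v₁ by a tree path, which E must contain, so E
-- still enters v₁, necessarily through f₁; then the vertex of E just below q₁ has ℓ₂ and z below it
-- but not ℓ₁, where z is a leaf reached by a tree path from a tree child of p₂. In E′, q₁ has ℓ₁
-- and z below it but not ℓ₂, since E′ enters v₂ from q₂. Vertices of an embedding carry the
-- clusters of the tree vertices they subdivide, and clusters of a tree sharing the leaf z are
-- nested, a contradiction.
module Submission where

open import Defs
open import Data.Bool using (Bool; true; false; if_then_else_)
import Data.Bool as Bool
open import Data.Bool.Properties using (¬-not; not-¬)
open import Data.Empty using (⊥; ⊥-elim)
open import Data.Fin using (Fin; zero; suc; toℕ; _≟_)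
open import Data.Fin.Properties using (pigeonhole)
open import Data.List using (List; []; _∷_; _++_; [_]; tabulate)
open import Data.List.Properties using (map-tabulate; ∷-injectiveˡ; ∷-injectiveʳ)
open import Data.List.Membership.Propositional using (_∈_; _∉_)
open import Data.List.Membership.Propositional.Properties using (∈-++⁺ˡ; ∈-++⁺ʳ; ∈-++⁻)
open import Data.List.Relation.Unary.All as All using (All; _∷_)
open import Data.List.Relation.Unary.Any using (here; there)
open import Data.List.Relation.Unary.Linked as Linked using (Linked; [-]; _∷_)
import Data.Nat as Nat
open import Data.Nat using (ℕ; zero; suc; _+_; _≤′_; ≤′-refl; ≤′-step)
open import Data.Nat.ListAction using (sum)
open import Data.Nat.Properties using (suc-injective; 1+n≢0; 0≢1+n; +-suc; m+n≡0⇒n≡0; n<1+n; <⇒<′)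
open import Data.Product using (∃; _×_; _,_; proj₁; proj₂)
open import Data.Sum using (_⊎_; inj₁; inj₂)
open import Function using (_∘_; _⇔_; mk⇔; Equivalence)
open import Relation.Binary.Construct.Closure.ReflexiveTransitive as Star using (Star; ε; _◅_; _◅◅_)
open import Relation.Binary.PropositionalEquality using (_≡_; _≢_; refl; sym; trans; cong; subst; module ≡-Reasoning)
open import Relation.Nullary using (¬_; Dec; yes; no; does)

indicator : Bool → ℕ
indicator b = if b then 1 else 0

count-tabulate : ∀ {n} (f : Fin n → Bool) → count f ≡ sum (tabulate (indicator ∘ f))
count-tabulate f = cong sum (map-tabulate (λ i → i) (indicator ∘ f))

count-suc : ∀ {n} (f : Fin (suc n) → Bool) → count f ≡ indicator (f zero) + count (f ∘ suc)
count-suc f = trans (count-tabulate f) (cong (indicator (f zero) +_) (sym (count-tabulate (f ∘ suc))))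

count-true : ∀ {n} (f : Fin (suc n) → Bool) → f zero ≡ true → count f ≡ suc (count (f ∘ suc))
count-true f f0 = trans (count-suc f) (cong (λ b → indicator b + count (f ∘ suc)) f0)

count-false : ∀ {n} (f : Fin (suc n) → Bool) → f zero ≡ false → count f ≡ count (f ∘ suc)
count-false f f0 = trans (count-suc f) (cong (λ b → indicator b + count (f ∘ suc)) f0)

count≡0⇒false : ∀ {n} (f : Fin n → Bool) → count f ≡ 0 → ∀ i → f i ≢ true
count≡0⇒false {suc n} f c zero    fi = 1+n≢0 (trans (sym (count-true f fi)) c)
count≡0⇒false {suc n} f c (suc i) = count≡0⇒false (f ∘ suc) (m+n≡0⇒n≡0 _ (trans (sym (count-suc f)) c)) i

count≡suc⇒witness : ∀ {n m} (f : Fin n → Bool) → count f ≡ suc m → ∃ λ i → f i ≡ true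
count≡suc⇒witness {suc n} f c with f zero Bool.≟ true
... | yes f0    = zero , f0
... | no f0≢true with count≡suc⇒witness (f ∘ suc) (trans (sym (count-false f (¬-not f0≢true))) c)
...   | i , fi = suc i , fi

_without_ : ∀ {n} → (Fin n → Bool) → Fin n → Fin n → Bool
(f without i) j = if does (j ≟ i) then false else f j

without-≢ : ∀ {n} (f : Fin n → Bool) {i j} → j ≢ i → (f without i) j ≡ f j
without-≢ f {i} {j} j≢i with j ≟ i
... | yes j≡i = ⊥-elim (j≢i j≡i)
... | no _    = refl

count-without : ∀ {n} (f : Fin n → Bool) i → f i ≡ true → count f ≡ suc (count (f without i))
count-without {suc n} f zero    fi = trans (count-true f fi) (cong suc (sym (count-false (f without zero) refl)))
count-without {suc n} f (suc i) fi = begin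
  count f                                                    ≡⟨ count-suc f ⟩
  indicator (f zero) + count (f ∘ suc)                       ≡⟨ cong (indicator (f zero) +_) (count-without (f ∘ suc) i fi) ⟩
  indicator (f zero) + suc (count ((f ∘ suc) without i))     ≡⟨ +-suc _ _ ⟩
  suc (indicator (f zero) + count ((f ∘ suc) without i))     ≡⟨ cong suc (sym (count-suc (f without suc i))) ⟩
  suc (count (f without suc i))                              ∎
  where open ≡-Reasoning

count≡1⇒unique : ∀ {n} (f : Fin n → Bool) → count f ≡ 1 →
                 ∀ {i j} → f i ≡ true → f j ≡ true → i ≡ j
count≡1⇒unique f c {i} {j} fi fj with j ≟ i
... | yes j≡i = sym j≡i
... | no j≢i  = ⊥-elim (count≡0⇒false (f without i) (suc-injective (trans (sym (count-without f i fi)) c))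
                                        j (trans (without-≢ f j≢i) fj))

count≡2⇒oneOf : ∀ {n} (f : Fin n → Bool) → count f ≡ 2 →
                ∀ {i j l} → f i ≡ true → f j ≡ true → i ≢ j → f l ≡ true → l ≡ i ⊎ l ≡ j
count≡2⇒oneOf f c {i} {j} {l} fi fj i≢j fl with l ≟ i
... | yes l≡i = inj₁ l≡i
... | no l≢i  = inj₂ (count≡1⇒unique (f without i) (suc-injective (trans (sym (count-without f i fi)) c))
                                     (trans (without-≢ f l≢i) fl) (trans (without-≢ f (i≢j ∘ sym)) fj))

module _ {A : Set} where

  lastFrom-snoc : ∀ (x : A) xs {z} → lastFrom x (xs ++ [ z ]) ≡ z
  lastFrom-snoc x []       = refl
  lastFrom-snoc x (y ∷ ys) = lastFrom-snoc y ys

  consec-∈-tail : ∀ {x : A} {xs u w} → Consec u w (x ∷ xs) → w ∈ xs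
  consec-∈-tail ([]     , _ , refl) = here refl
  consec-∈-tail (_ ∷ ys , _ , refl) = ∈-++⁺ʳ ys (there (here refl))

  consec-∈-init : ∀ (xs : List A) {z u w} → Consec u w (xs ++ [ z ]) → u ∈ xs
  consec-∈-init []       ([]         , _ , ())
  consec-∈-init []       (_ ∷ []     , _ , ())
  consec-∈-init []       (_ ∷ _ ∷ _ , _ , ())
  consec-∈-init (_ ∷ _)  ([]         , _ , eq) = here (sym (∷-injectiveˡ eq))
  consec-∈-init (_ ∷ xs) (_ ∷ ys     , zs , eq) = there (consec-∈-init xs (ys , zs , ∷-injectiveʳ eq))

  consec-split : ∀ {x : A} xs {z u w} → Consec u w (x ∷ xs ++ [ z ]) →
                 (u ≡ x ⊎ u ∈ xs) × (w ∈ xs ⊎ w ≡ z)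
  consec-split {x} xs {z} {u} {w} c = first (consec-∈-init (x ∷ xs) c) , second (∈-++⁻ xs (consec-∈-tail c))
    where
      first : u ∈ x ∷ xs → u ≡ x ⊎ u ∈ xs
      first (here u≡x) = inj₁ u≡x
      first (there m)  = inj₂ m

      second : w ∈ xs ⊎ w ∈ [ z ] → w ∈ xs ⊎ w ≡ z
      second (inj₁ m)          = inj₁ m
      second (inj₂ (here w≡z)) = inj₂ w≡z

module _ {A : Set} {R : A → A → Set} where

  unsnoc : ∀ {u w} → Star R u w → u ≡ w ⊎ ∃ λ v → Star R u v × R v w
  unsnoc ε = inj₁ refl
  unsnoc (r ◅ p) with unsnoc p
  ... | inj₁ refl          = inj₂ (_ , ε , r)
  ... | inj₂ (v , p′ , r′) = inj₂ (v , r ◅ p′ , r′)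

  uncons : ∀ {u w} → Star R u w → u ≢ w → ∃ λ v → R u v × Star R v w
  uncons ε       u≢u = ⊥-elim (u≢u refl)
  uncons (r ◅ p) _   = _ , r , p

  Linked⇒Star : ∀ {u vs v} → Linked R (u ∷ vs) → lastFrom u vs ≡ v → Star R u v
  Linked⇒Star {vs = []}    _       refl = ε
  Linked⇒Star {vs = _ ∷ _} (r ∷ l) eq   = r ◅ Linked⇒Star l eq

  Linked-All⇒Star : ∀ {P : A → Set} {u vs v} → Linked R (u ∷ vs) → lastFrom u vs ≡ v → All P vs →
                    Star (λ a b → R a b × P b) u v
  Linked-All⇒Star {vs = []}    _       refl _          = ε
  Linked-All⇒Star {vs = _ ∷ _} (r ∷ l) eq   (pw ∷ ps) = (r , pw) ◅ Linked-All⇒Star l eq ps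

  Star⇒Linked : ∀ {u v} → Star R u v → ∃ λ vs → Linked R (u ∷ vs) × lastFrom u vs ≡ v
  Star⇒Linked ε = [] , [-] , refl
  Star⇒Linked (r ◅ p) with Star⇒Linked p
  ... | vs , l , eq = _ ∷ vs , r ∷ l , eq

  linked-pred : ∀ {x xs w} → Linked R (x ∷ xs) → w ∈ xs → ∃ λ u → R u w
  linked-pred (r ∷ _) (here refl) = _ , r
  linked-pred (_ ∷ l) (there m)   = linked-pred l m

  linked-∈⇒path : ∀ {x xs w} → Linked R (x ∷ xs) → w ∈ xs → ∃ λ v → R x v × Star R v w
  linked-∈⇒path (r ∷ _) (here refl) = _ , r , ε
  linked-∈⇒path (r ∷ l) (there m) with linked-∈⇒path l m
  ... | _ , r′ , p = _ , r , r′ ◅ p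

  consec-prefix : ∀ {x xs u w} → Linked R (x ∷ xs) → Consec u w (x ∷ xs) → Star R x w
  consec-prefix (r ∷ _) ([]           , _  , refl) = r ◅ ε
  consec-prefix (r ∷ l) (_ ∷ []       , zs , refl) = r ◅ consec-prefix l ([] , zs , refl)
  consec-prefix (r ∷ l) (_ ∷ y ∷ ys   , zs , refl) = r ◅ consec-prefix l (y ∷ ys , zs , refl)

  consec-suffix : ∀ {x xs u w} → Linked R (x ∷ xs) → Consec u w (x ∷ xs) → Star R w (lastFrom x xs)
  consec-suffix (_ ∷ l) ([]           , _  , refl) = Linked⇒Star l refl
  consec-suffix (_ ∷ l) (_ ∷ []       , zs , refl) = consec-suffix l ([] , zs , refl)
  consec-suffix (_ ∷ l) (_ ∷ y ∷ ys   , zs , refl) = consec-suffix l (y ∷ ys , zs , refl)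

  module _ (acyclic : ∀ {u v} → R u v → Star R v u → ⊥) where

    linked-head∉tail : ∀ {x xs} → Linked R (x ∷ xs) → x ∉ xs
    linked-head∉tail l m with linked-∈⇒path l m
    ... | _ , r , p = acyclic r p

    consec-pred-unique : ∀ {xs u u′ w} → Linked R xs → Consec u w xs → Consec u′ w xs → u ≡ u′
    consec-pred-unique _ ([] , _ , refl) ([] , _ , refl) = refl
    consec-pred-unique l ([] , _ , refl) (_ ∷ ys , zs , eq) =
      ⊥-elim (linked-head∉tail (Linked.tail l) (consec-∈-tail (ys , zs , ∷-injectiveʳ eq)))
    consec-pred-unique l (_ ∷ ys , zs , eq) ([] , _ , refl) =
      ⊥-elim (linked-head∉tail (Linked.tail l) (consec-∈-tail (ys , zs , ∷-injectiveʳ eq)))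
    consec-pred-unique l (_ ∷ ys , zs , refl) (_ ∷ ys′ , zs′ , eq) =
      consec-pred-unique (Linked.tail l) (ys , zs , refl) (ys′ , zs′ , ∷-injectiveʳ eq)

module _ {n : ℕ} {S : Fin n → Fin n → Set} {Stop : Fin n → Set}
         (acyclic : ∀ {u v} → S u v → Star S v u → ⊥)
         (stop? : ∀ v → Dec (Stop v)) (step : ∀ v → ¬ Stop v → ∃ (S v)) where

  private
    choose : ∀ v → Dec (Stop v) → Fin n
    choose v (yes _)    = v
    choose v (no ¬stop) = proj₁ (step v ¬stop)

    next : Fin n → Fin n
    next v = choose v (stop? v)

    next-cases : ∀ v → (Stop v × next v ≡ v) ⊎ (¬ Stop v × S v (next v))
    next-cases v = cases (stop? v)
      where
        cases : (d : Dec (Stop v)) → (Stop v × choose v d ≡ v) ⊎ (¬ Stop v × S v (choose v d))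
        cases (yes stop)  = inj₁ (stop , refl)
        cases (no ¬stop) = inj₂ (¬stop , proj₂ (step v ¬stop))

    walk : Fin n → ℕ → Fin n
    walk v zero    = v
    walk v (suc m) = next (walk v m)

    walk-path : ∀ v m → Star S v (walk v m)
    walk-path v zero = ε
    walk-path v (suc m) with next-cases (walk v m)
    ... | inj₁ (_ , stays)  = subst (Star S v) (sym stays) (walk-path v m)
    ... | inj₂ (_ , steps) = walk-path v m ◅◅ steps ◅ ε

    stops-or-advances : ∀ v {i j} → suc i ≤′ j →
                        Stop (walk v j) ⊎ ∃ λ x → S (walk v i) x × Star S x (walk v j)
    stops-or-advances v {i} ≤′-refl with next-cases (walk v i)
    ... | inj₁ (stop , stays) = inj₁ (subst Stop (sym stays) stop)
    ... | inj₂ (_ , steps)    = inj₂ (_ , steps , ε)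
    stops-or-advances v {i} {suc j} (≤′-step i<j) with next-cases (walk v j)
    ... | inj₁ (stop , stays) = inj₁ (subst Stop (sym stays) stop)
    ... | inj₂ (¬stop , steps) with stops-or-advances v i<j
    ...   | inj₁ stop            = ⊥-elim (¬stop stop)
    ...   | inj₂ (x , s , x⇝wj) = inj₂ (x , s , x⇝wj ◅◅ steps ◅ ε)

  -- A walk of n + 1 steps revisits a vertex; without a stop in between this closes a cycle.
  walk-to-stop : ∀ v → ∃ λ w → Stop w × Star S v w
  walk-to-stop v with pigeonhole (n<1+n n) (walk v ∘ toℕ)
  ... | i , j , i<j , wi≡wj with stops-or-advances v (<⇒<′ i<j)
  ...   | inj₁ stop            = _ , stop , walk-path v (toℕ j)
  ...   | inj₂ (x , s , x⇝wj) = ⊥-elim (acyclic s (subst (Star S x) (sym wi≡wj) x⇝wj))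

module DigraphFacts (G : Digraph) where
  open Digraph G

  TreeArc : V → V → Set
  TreeArc u v = u ⟶ v × indeg v ≡ 1

  treePath⇒path : ∀ {u v} → Star TreeArc u v → Star _⟶_ u v
  treePath⇒path = Star.map proj₁

  TreePath⇒Star : ∀ {u v} → TreePath u v → Star TreeArc u v
  TreePath⇒Star (_ , (l , eq) , ps) = Linked-All⇒Star l eq (All.map indeg≡1 ps)
    where
      indeg≡1 : ∀ {w} → isTreeV w ⊎ isLeafV w → indeg w ≡ 1
      indeg≡1 (inj₁ (d , _)) = d
      indeg≡1 (inj₂ (d , _)) = d

  DPath⇒Star : ∀ {u v} → DPath u v → Star _⟶_ u v
  DPath⇒Star (_ , l , eq) = Linked⇒Star l eq

  outdeg≢0 : ∀ {u v} → u ⟶ v → outdeg u ≢ 0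
  outdeg≢0 {u} uv d = count≡0⇒false (arc u) d _ uv

  parent-unique : ∀ {u u′ v} → indeg v ≡ 1 → u ⟶ v → u′ ⟶ v → u ≡ u′
  parent-unique {v = v} d = count≡1⇒unique (λ u → arc u v) d

  reach-through-treePath : ∀ {Rel : V → V → Set} → (∀ {a b} → Rel a b → a ⟶ b) →
                           ∀ {top x y} → Star TreeArc top x → Star Rel y x →
                           Star Rel y top ⊎ Star _⟶_ top y
  reach-through-treePath sub ε                 y⇝x = inj₁ y⇝x
  reach-through-treePath sub ((a , d) ◅ t⇝x) y⇝x with reach-through-treePath sub t⇝x y⇝x
  ... | inj₂ t⇝y = inj₂ (a ◅ t⇝y)
  ... | inj₁ y⇝t with unsnoc y⇝t
  ...   | inj₁ refl             = inj₂ (a ◅ ε)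
  ...   | inj₂ (_ , y⇝u , u→t) with parent-unique d (sub u→t) a
  ...     | refl = inj₁ y⇝u

module NetworkFacts {k : ℕ} (N : Network k) where
  open Network N
  open DigraphFacts graph public

  ¬cycle : ∀ {u v} → u ⟶ v → Star _⟶_ v u → ⊥
  ¬cycle {u} {v} uv v⇝u with Star⇒Linked v⇝u
  ... | vs , l , eq = acyclic u v vs (uv ∷ l , eq)

  reach-antisym : ∀ {u v} → Star _⟶_ u v → Star _⟶_ v u → u ≡ v
  reach-antisym ε         _   = refl
  reach-antisym (uw ◅ w⇝v) v⇝u = ⊥-elim (¬cycle uw (w⇝v ◅◅ v⇝u))

  root-no-parent : ∀ {u} → ¬ u ⟶ root
  root-no-parent = count≡0⇒false (λ u → arc u root) (proj₁ root-deg) _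

  leaf≢root : ∀ x → leaf x ≢ root
  leaf≢root x eq = 0≢1+n (trans (sym (proj₁ root-deg)) (subst (λ v → indeg v ≡ 1) eq (proj₁ (leaf-deg x))))

  parent-exists : ∀ v → v ≢ root → ∃ λ u → u ⟶ v
  parent-exists v v≢root with other-deg v v≢root
  ... | inj₁ (d , _)        = count≡suc⇒witness (λ u → arc u v) d
  ... | inj₂ (inj₁ (d , _)) = count≡suc⇒witness (λ u → arc u v) d
  ... | inj₂ (inj₂ (d , _)) = count≡suc⇒witness (λ u → arc u v) d

  child-indeg : ∀ {u v} → u ⟶ v → indeg v ≡ 1 ⊎ isRet v
  child-indeg {u} {v} uv with v ≟ root
  ... | yes refl = ⊥-elim (root-no-parent uv)
  ... | no v≢root with other-deg v v≢root
  ...   | inj₁ (d , _)        = inj₁ d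
  ...   | inj₂ (inj₁ (d , _)) = inj₁ d
  ...   | inj₂ (inj₂ ret)     = inj₂ ret

  two-parents : ∀ {u u′ v w} → u ⟶ v → u′ ⟶ v → u ≢ u′ → w ⟶ v → w ≡ u ⊎ w ≡ u′
  two-parents {v = v} uv u′v u≢u′ wv with child-indeg uv
  ... | inj₁ d       = ⊥-elim (u≢u′ (parent-unique d uv u′v))
  ... | inj₂ (d , _) = count≡2⇒oneOf (λ u → arc u v) d uv u′v u≢u′ wv

  phyloTree-arc : IsPhyloTree N → ∀ {u v} → u ⟶ v → TreeArc u v
  phyloTree-arc tree uv with child-indeg uv
  ... | inj₁ d   = uv , d
  ... | inj₂ ret = ⊥-elim (tree _ ret)

  clusters-nested : IsPhyloTree N → ∀ {t t′ z} → Star _⟶_ t z → Star _⟶_ t′ z →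
                    Star _⟶_ t′ t ⊎ Star _⟶_ t t′
  clusters-nested tree t⇝z = reach-through-treePath (λ a → a) (Star.map (phyloTree-arc tree) t⇝z)

  reachable-from-root : ∀ v → Star _⟶_ root v
  reachable-from-root v with walk-to-stop {S = λ u w → w ⟶ u} (λ vu u⇝v → ¬cycle vu (Star.reverse (λ a → a) u⇝v))
                                         (_≟ root) parent-exists v
  ... | _ , refl , v⇝root = Star.reverse (λ a → a) v⇝root

  module _ (tc : TreeChild N) where

    tree-child : ∀ u → outdeg u ≢ 0 → ∃ (TreeArc u)
    tree-child u d with tc u d
    ... | c , uc , inj₁ (cd , _) = c , uc , cd
    ... | c , uc , inj₂ (cd , _) = c , uc , cd

    leaf-below : ∀ v → ∃ λ x → Star TreeArc v (leaf x)
    leaf-below v with walk-to-stop (λ { (a , _) p → ¬cycle a (treePath⇒path p) })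
                                   (λ w → outdeg w Nat.≟ 0) tree-child v
    ... | w , w-leaf , v⇝w with leaves-X w w-leaf
    ...   | x , refl = x , v⇝w

module EmbeddingFacts {k : ℕ} {T N : Network k} (T-tree : IsPhyloTree T)
                      {E : ArcSet N} (emb : Embedding T N E) where
  open Embedding emb
  private
    module T = Network T
    module N = Network N
    module TF = NetworkFacts T
    module NF = NetworkFacts N

  infix 4 _→ᴱ_
  _→ᴱ_ : N.V → N.V → Set
  u →ᴱ v = Uses {N = N} E u v

  HasParentᴱ : N.V → Set
  HasParentᴱ v = ∃ λ u → u →ᴱ v

  rootᴱ : N.V
  rootᴱ = ψ T.root

  arcᴱ⇒arc : ∀ {u v} → u →ᴱ v → N._⟶_ u v
  arcᴱ⇒arc = E⊆N _ _

  pathᴱ⇒path : ∀ {u v} → Star _→ᴱ_ u v → Star N._⟶_ u v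
  pathᴱ⇒path = Star.map arcᴱ⇒arc

  ¬cycleᴱ : ∀ {u v} → u →ᴱ v → Star _→ᴱ_ v u → ⊥
  ¬cycleᴱ uv v⇝u = NF.¬cycle (arcᴱ⇒arc uv) (pathᴱ⇒path v⇝u)

  arc-image : ∀ {a b} → T._⟶_ a b → Star _→ᴱ_ (ψ a) (ψ b)
  arc-image {a} {b} ab = Linked⇒Star (route-path a b ab) (lastFrom-snoc (ψ a) (route a b))

  path-image : ∀ {a b} → Star T._⟶_ a b → Star _→ᴱ_ (ψ a) (ψ b)
  path-image = Star.concat ∘ Star.gmap ψ arc-image

  -- y lies on the subdivision of the arc (a, b), strictly below ψ a.
  Position : T.V → T.V → N.V → Set
  Position a b y = y ∈ route a b ⊎ y ≡ ψ b

  position-of-head : ∀ {u w a b} → Consec u w (full a b) → Position a b w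
  position-of-head c = proj₂ (consec-split _ c)

  same-position : ∀ {a b a′ b′ w} → T._⟶_ a b → T._⟶_ a′ b′ →
                  Position a b w → Position a′ b′ w → a ≡ a′ × b ≡ b′
  same-position ab a′b′ (inj₁ m) (inj₁ m′) = route-disj _ _ _ _ _ ab a′b′ m m′
  same-position ab a′b′ (inj₁ m) (inj₂ e′) = ⊥-elim (route-fresh _ _ _ _ ab m e′)
  same-position ab a′b′ (inj₂ e) (inj₁ m′) = ⊥-elim (route-fresh _ _ _ _ a′b′ m′ e)
  same-position ab a′b′ (inj₂ e) (inj₂ e′) with ψ-inj (trans (sym e) e′)
  ... | refl = TF.parent-unique (proj₂ (TF.phyloTree-arc T-tree ab)) ab a′b′ , refl

  parentᴱ-unique : ∀ {u u′ w} → u →ᴱ w → u′ →ᴱ w → u ≡ u′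
  parentᴱ-unique {u} {u′} {w} uw u′w with E-covered u w uw | E-covered u′ w u′w
  ... | a , b , ab , c | a′ , b′ , a′b′ , c′
    with same-position ab a′b′ (position-of-head c) (position-of-head c′)
  ... | refl , refl = consec-pred-unique ¬cycleᴱ (route-path a b ab) c c′

  image-hasParentᴱ : ∀ a → a ≢ T.root → HasParentᴱ (ψ a)
  image-hasParentᴱ a a≢root with TF.parent-exists a a≢root
  ... | a₀ , a₀a = linked-pred (route-path a₀ a a₀a) (∈-++⁺ʳ (route a₀ a) (here refl))

  leaf-hasParentᴱ : ∀ x → HasParentᴱ (N.leaf x)
  leaf-hasParentᴱ x = subst HasParentᴱ (ψ-leaf x) (image-hasParentᴱ (T.leaf x) (TF.leaf≢root x))

  hasParentᴱ-of-tail : ∀ {u w} → u →ᴱ w → u ≢ rootᴱ → HasParentᴱ u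
  hasParentᴱ-of-tail {u} {w} uw u≢root with E-covered u w uw
  ... | a , b , ab , c with proj₁ (consec-split (route a b) c)
  ...   | inj₁ refl = image-hasParentᴱ a (u≢root ∘ cong ψ)
  ...   | inj₂ m    = linked-pred (route-path a b ab) (∈-++⁺ˡ m)

  hasParentᴱ-backward : ∀ {t b} → Star _→ᴱ_ t b → HasParentᴱ b → t ≢ rootᴱ → HasParentᴱ t
  hasParentᴱ-backward ε          hb _      = hb
  hasParentᴱ-backward (tw ◅ _) _  t≢root = hasParentᴱ-of-tail tw t≢root

  rootᴱ-reaches : ∀ {w} → HasParentᴱ w → Star _→ᴱ_ rootᴱ w
  rootᴱ-reaches (u , uw) with E-covered u _ uw
  ... | a , b , ab , c = path-image (TF.reachable-from-root a) ◅◅ consec-prefix (route-path a b ab) c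

  rootᴱ-reaches-tail : ∀ {u w} → u →ᴱ w → Star N._⟶_ rootᴱ u
  rootᴱ-reaches-tail {u} uw with u ≟ rootᴱ
  ... | yes refl    = ε
  ... | no u≢root = pathᴱ⇒path (rootᴱ-reaches (hasParentᴱ-of-tail uw u≢root))

  below-rootᴱ : ∀ {u v} → Star N._⟶_ rootᴱ u → N._⟶_ u v → v ≢ rootᴱ
  below-rootᴱ root⇝u uv refl = NF.¬cycle uv root⇝u

  strictly-below-rootᴱ : ∀ {u v} → Star N._⟶_ rootᴱ u → Star N._⟶_ u v → u ≢ v → v ≢ rootᴱ
  strictly-below-rootᴱ root⇝u u⇝v u≢v refl = u≢v (NF.reach-antisym u⇝v root⇝u)

  treeArcᴱ : ∀ {u v} → NF.TreeArc u v → HasParentᴱ v → u →ᴱ v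
  treeArcᴱ (uv , d) (u′ , u′v) with NF.parent-unique d (arcᴱ⇒arc u′v) uv
  ... | refl = u′v

  -- A tree vertex has a single parent, so the embedding can only enter it through its tree arc.
  treePathᴱ : ∀ {top bot} → Star N._⟶_ rootᴱ top → Star NF.TreeArc top bot → HasParentᴱ bot →
              Star _→ᴱ_ top bot
  treePathᴱ root⇝t ε                          _  = ε
  treePathᴱ {bot = bot} root⇝t (_◅_ {j = x} tx@(t⟶x , _) x⇝b) hb =
    treeArcᴱ tx (hasParentᴱ-backward x⇝bᴱ hb (below-rootᴱ root⇝t t⟶x)) ◅ x⇝bᴱ
    where
      x⇝bᴱ : Star _→ᴱ_ x bot
      x⇝bᴱ = treePathᴱ (root⇝t ◅◅ t⟶x ◅ ε) x⇝b hb

  treePath-to-leafᴱ : ∀ {u v x} → Star N._⟶_ rootᴱ u → N._⟶_ u v → Star NF.TreeArc v (N.leaf x) →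
                      HasParentᴱ v × Star _→ᴱ_ v (N.leaf x)
  treePath-to-leafᴱ {v = v} {x} root⇝u uv v⇝x =
    hasParentᴱ-backward v⇝xᴱ (leaf-hasParentᴱ _) (below-rootᴱ root⇝u uv) , v⇝xᴱ
    where
      v⇝xᴱ : Star _→ᴱ_ v (N.leaf x)
      v⇝xᴱ = treePathᴱ (root⇝u ◅◅ uv ◅ ε) v⇝x (leaf-hasParentᴱ _)

  descend : ∀ {a b y x} → T._⟶_ a b → Position a b y → Star _→ᴱ_ y (N.leaf x) → Star T._⟶_ b (T.leaf x)
  descend ab (inj₁ m) ε = ⊥-elim (route-fresh _ _ _ _ ab m (sym (ψ-leaf _)))
  descend ab (inj₂ e) ε with ψ-inj (trans (ψ-leaf _) e)
  ... | refl = ε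
  descend {a} {b} {y} {x} ab pos (yy′ ◅ y′⇝x) with E-covered _ _ yy′
  ... | a′ , b′ , a′b′ , c = continue pos (proj₁ (consec-split (route a′ b′) c))
    where
      continue : Position a b y → y ≡ ψ a′ ⊎ y ∈ route a′ b′ → Star T._⟶_ b (T.leaf x)
      continue (inj₁ m) (inj₁ e)  = ⊥-elim (route-fresh _ _ _ _ ab m e)
      continue (inj₁ m) (inj₂ m′) with route-disj _ _ _ _ _ ab a′b′ m m′
      ... | refl , refl = descend ab (position-of-head c) y′⇝x
      continue (inj₂ e) (inj₁ e′) with ψ-inj (trans (sym e) e′)
      ... | refl = a′b′ ◅ descend a′b′ (position-of-head c) y′⇝x
      continue (inj₂ e) (inj₂ m′) = ⊥-elim (route-fresh _ _ _ _ a′b′ m′ e)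

  image-cluster : ∀ {y} → HasParentᴱ y →
                  ∃ λ t → ∀ x → Star _→ᴱ_ y (N.leaf x) ⇔ Star T._⟶_ t (T.leaf x)
  image-cluster {y} (u , uy) with E-covered u _ uy
  ... | a , b , ab , c = b , λ x → mk⇔ (descend ab (position-of-head c)) (λ b⇝x → y⇝ψb ◅◅ leaf-image b⇝x)
    where
      y⇝ψb : Star _→ᴱ_ y (ψ b)
      y⇝ψb = subst (Star _→ᴱ_ _) (lastFrom-snoc (ψ a) (route a b)) (consec-suffix (route-path a b ab) c)
      leaf-image : ∀ {x} → Star T._⟶_ b (T.leaf x) → Star _→ᴱ_ (ψ b) (N.leaf x)
      leaf-image {x} = subst (Star _→ᴱ_ (ψ b)) (ψ-leaf x) ∘ path-image

  Separates : Fin k → Fin k → Fin k → Set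
  Separates a z b = ∃ λ y → HasParentᴱ y × Star _→ᴱ_ y (N.leaf a) × Star _→ᴱ_ y (N.leaf z) ×
                            ¬ Star _→ᴱ_ y (N.leaf b)

-- Clusters of a tree sharing a leaf are nested, so the cluster of one embedding's vertex
-- cannot cross that of the other's.
separations-incompatible : ∀ {k} {T N : Network k} (T-tree : IsPhyloTree T) {E E′ : ArcSet N}
                           (emb : Embedding T N E) (emb′ : Embedding T N E′) {a b z : Fin k} →
                           EmbeddingFacts.Separates T-tree emb a z b →
                           EmbeddingFacts.Separates T-tree emb′ b z a → ⊥
separations-incompatible {T = T} T-tree emb emb′ {a} {b} {z}
  (y , y∈E , y⇝a , y⇝z , ¬y⇝b) (y′ , y′∈E′ , y′⇝b , y′⇝z , ¬y′⇝a)
  with EmbeddingFacts.image-cluster T-tree emb y∈E | EmbeddingFacts.image-cluster T-tree emb′ y′∈E′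
... | t , cluster | t′ , cluster′
  with NetworkFacts.clusters-nested T T-tree (Equivalence.to (cluster z) y⇝z) (Equivalence.to (cluster′ z) y′⇝z)
... | inj₁ t′⇝t = ¬y′⇝a (Equivalence.from (cluster′ a) (t′⇝t ◅◅ Equivalence.to (cluster a) y⇝a))
... | inj₂ t⇝t′ = ¬y⇝b (Equivalence.from (cluster b) (t⇝t′ ◅◅ Equivalence.to (cluster′ b) y′⇝b))

module Ladder {k : ℕ} {N : Network k} {ℓ₀ ℓ₁ ℓ₂ : Fin k} {φ : CLVertex → Network.V N}
              (L : LooseLadder N ℓ₀ ℓ₁ ℓ₂ φ) {T : Network k} (T-tree : IsPhyloTree T)
              {c : Network.V N} {z : Fin k}
              (p₂c : DigraphFacts.TreeArc (Network.graph N) (φ p₂) c)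
              (c⇝z : Star (DigraphFacts.TreeArc (Network.graph N)) c (Network.leaf N z)) where
  open Network N
  open NetworkFacts N
  open LooseLadder L

  φ-distinct : ∀ {a b} → a ≢ b → φ a ≢ φ b
  φ-distinct a≢b = a≢b ∘ φ-inj

  q₂⇝q₁ : Star TreeArc (φ q₂) (φ q₁)
  q₂⇝q₁ = TreePath⇒Star P3-q₂q₁

  q₁⇝p₂ : Star TreeArc (φ q₁) (φ p₂)
  q₁⇝p₂ = TreePath⇒Star P3-q₁p₂

  p₂⇝p₁ : Star _⟶_ (φ p₂) (φ p₁)
  p₂⇝p₁ = DPath⇒Star P3-p₂p₁

  v₁⇝ℓ₁ : Star TreeArc (φ v₁) (leaf ℓ₁)
  v₁⇝ℓ₁ = TreePath⇒Star P1-1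

  v₂⇝ℓ₂ : Star TreeArc (φ v₂) (leaf ℓ₂)
  v₂⇝ℓ₂ = TreePath⇒Star P1-2

  parents-v₁ : ∀ {u} → u ⟶ φ v₁ → u ≡ φ p₁ ⊎ u ≡ φ q₁
  parents-v₁ = two-parents P2-e₁ P2-f₁ (φ-distinct λ ())

  parents-v₂ : ∀ {u} → u ⟶ φ v₂ → u ≡ φ p₂ ⊎ u ≡ φ q₂
  parents-v₂ = two-parents P2-e₂ P2-f₂ (φ-distinct λ ())

  -- Not using e₁, the embedding reaches v₁ through f₁; the vertex below q₁ then sees ℓ₂ and z, not ℓ₁.
  separates-via-e₂ : ∀ {E} (emb : Embedding T N E) → Uses {N = N} E (φ p₂) (φ v₂) →
                     ¬ Uses {N = N} E (φ p₁) (φ v₁) → EmbeddingFacts.Separates T-tree emb ℓ₂ z ℓ₁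
  separates-via-e₂ emb e₂ ¬e₁ = below-q₁ (uncons q₁⇝p₂ᴱ (φ-distinct λ ()))
    where
      open EmbeddingFacts T-tree emb

      root⇝p₂ : Star _⟶_ rootᴱ (φ p₂)
      root⇝p₂ = rootᴱ-reaches-tail e₂

      f₁ : φ q₁ →ᴱ φ v₁
      f₁ with proj₁ (treePath-to-leafᴱ (root⇝p₂ ◅◅ p₂⇝p₁) P2-e₁ v₁⇝ℓ₁)
      ... | u , uv₁ with parents-v₁ (arcᴱ⇒arc uv₁)
      ...   | inj₁ refl = ⊥-elim (¬e₁ uv₁)
      ...   | inj₂ refl = uv₁

      root⇝q₁ : Star _⟶_ rootᴱ (φ q₁)
      root⇝q₁ = rootᴱ-reaches-tail f₁

      c-hangs : HasParentᴱ c × Star _→ᴱ_ c (leaf z)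
      c-hangs = treePath-to-leafᴱ (root⇝q₁ ◅◅ treePath⇒path q₁⇝p₂) (proj₁ p₂c) c⇝z

      v₂⇝ℓ₂ᴱ : Star _→ᴱ_ (φ v₂) (leaf ℓ₂)
      v₂⇝ℓ₂ᴱ = proj₂ (treePath-to-leafᴱ (root⇝q₁ ◅◅ treePath⇒path q₁⇝p₂) P2-e₂ v₂⇝ℓ₂)

      q₁⇝p₂ᴱ : Star _→ᴱ_ (φ q₁) (φ p₂)
      q₁⇝p₂ᴱ = treePathᴱ root⇝q₁ q₁⇝p₂
                 (hasParentᴱ-of-tail e₂ (strictly-below-rootᴱ root⇝q₁ (treePath⇒path q₁⇝p₂) (φ-distinct λ ())))

      below-q₁ : (∃ λ y → φ q₁ →ᴱ y × Star _→ᴱ_ y (φ p₂)) → Separates ℓ₂ z ℓ₁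
      below-q₁ (y , q₁y , y⇝p₂) =
        y , (φ q₁ , q₁y) , y⇝p₂ ◅◅ e₂ ◅ v₂⇝ℓ₂ᴱ , y⇝p₂ ◅◅ treeArcᴱ p₂c (proj₁ c-hangs) ◅ proj₂ c-hangs , ¬y⇝ℓ₁
        where
          v₁-above-y : ¬ Star _⟶_ (φ v₁) y
          v₁-above-y v₁⇝y = φ-distinct (λ ()) (reach-antisym (v₁⇝y ◅◅ pathᴱ⇒path y⇝p₂ ◅◅ p₂⇝p₁) (P2-e₁ ◅ ε))

          ¬y⇝ℓ₁ : ¬ Star _→ᴱ_ y (leaf ℓ₁)
          ¬y⇝ℓ₁ y⇝ℓ₁ with reach-through-treePath arcᴱ⇒arc v₁⇝ℓ₁ y⇝ℓ₁
          ... | inj₂ v₁⇝y = v₁-above-y v₁⇝y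
          ... | inj₁ y⇝v₁ with unsnoc y⇝v₁
          ...   | inj₁ refl              = v₁-above-y ε
          ...   | inj₂ (u , y⇝u , uv₁) with parents-v₁ (arcᴱ⇒arc uv₁)
          ...     | inj₁ refl = ¬e₁ uv₁
          ...     | inj₂ refl = ¬cycleᴱ q₁y y⇝u

  -- q₁ sees ℓ₁ through f₁ and z through p₂, but cannot reach ℓ₂ once v₂ hangs from q₂.
  separates-via-f : ∀ {E′} (emb′ : Embedding T N E′) → Uses {N = N} E′ (φ q₁) (φ v₁) →
                    Uses {N = N} E′ (φ q₂) (φ v₂) → EmbeddingFacts.Separates T-tree emb′ ℓ₁ z ℓ₂
  separates-via-f emb′ f₁ f₂ =
    φ q₁ , hasParentᴱ-of-tail f₁ q₁≢root , f₁ ◅ v₁⇝ℓ₁ᴱ , q₁⇝p₂ᴱ ◅◅ p₂cᴱ ◅ proj₂ c-hangs , ¬q₁⇝ℓ₂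
    where
      open EmbeddingFacts T-tree emb′

      root⇝q₂ : Star _⟶_ rootᴱ (φ q₂)
      root⇝q₂ = rootᴱ-reaches-tail f₂

      q₂⇝p₂ : Star _⟶_ (φ q₂) (φ p₂)
      q₂⇝p₂ = treePath⇒path q₂⇝q₁ ◅◅ treePath⇒path q₁⇝p₂

      q₁≢root : φ q₁ ≢ rootᴱ
      q₁≢root = strictly-below-rootᴱ root⇝q₂ (treePath⇒path q₂⇝q₁) (φ-distinct λ ())

      v₁⇝ℓ₁ᴱ : Star _→ᴱ_ (φ v₁) (leaf ℓ₁)
      v₁⇝ℓ₁ᴱ = proj₂ (treePath-to-leafᴱ (root⇝q₂ ◅◅ treePath⇒path q₂⇝q₁) P2-f₁ v₁⇝ℓ₁)

      c-hangs : HasParentᴱ c × Star _→ᴱ_ c (leaf z)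
      c-hangs = treePath-to-leafᴱ (root⇝q₂ ◅◅ q₂⇝p₂) (proj₁ p₂c) c⇝z

      p₂cᴱ : φ p₂ →ᴱ c
      p₂cᴱ = treeArcᴱ p₂c (proj₁ c-hangs)

      q₁⇝p₂ᴱ : Star _→ᴱ_ (φ q₁) (φ p₂)
      q₁⇝p₂ᴱ = treePathᴱ (root⇝q₂ ◅◅ treePath⇒path q₂⇝q₁) q₁⇝p₂
                 (hasParentᴱ-of-tail p₂cᴱ (strictly-below-rootᴱ root⇝q₂ q₂⇝p₂ (φ-distinct λ ())))

      ¬q₁⇝ℓ₂ : ¬ Star _→ᴱ_ (φ q₁) (leaf ℓ₂)
      ¬q₁⇝ℓ₂ q₁⇝ℓ₂ with reach-through-treePath arcᴱ⇒arc v₂⇝ℓ₂ q₁⇝ℓ₂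
      ... | inj₂ v₂⇝q₁ = φ-distinct (λ ()) (reach-antisym v₂⇝q₁ (treePath⇒path q₁⇝p₂ ◅◅ P2-e₂ ◅ ε))
      ... | inj₁ q₁⇝v₂ with unsnoc q₁⇝v₂
      ...   | inj₁ q₁≡v₂            = φ-distinct (λ ()) q₁≡v₂
      ...   | inj₂ (u , q₁⇝u , uv₂) with parents-v₂ (arcᴱ⇒arc uv₂)
      ...     | inj₁ refl = φ-distinct (λ ()) (parentᴱ-unique uv₂ f₂)
      ...     | inj₂ refl = φ-distinct (λ ()) (reach-antisym (treePath⇒path q₂⇝q₁) (pathᴱ⇒path q₁⇝u))

-- The argument does not need f₂ to be non-essential.
corollary2 : ∀ {k : ℕ} (N : Network k) → TreeChild N →
    ∀ (ℓ₀ ℓ₁ ℓ₂ : Fin k) (φ : CLVertex → Network.V N) →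
    LooseLadder N ℓ₀ ℓ₁ ℓ₂ φ →
    ¬ Essential N (φ q₂) (φ v₂) →
    ∀ (T : Network k) → IsPhyloTree T →
    ∀ (E E′ : ArcSet N) → Embedding T N E → Embedding T N E′ →
    Uses {N = N} E′ (φ q₁) (φ v₁) → Uses {N = N} E′ (φ q₂) (φ v₂) →
    Uses {N = N} E (φ p₂) (φ v₂) →
    Uses {N = N} E (φ p₁) (φ v₁)
corollary2 N tc ℓ₀ ℓ₁ ℓ₂ φ L _ T T-tree E E′ emb emb′ f₁ f₂ e₂ with E (φ p₁) (φ v₁) in e₁
... | true  = refl
... | false with NetworkFacts.tree-child N tc (φ p₂) (NetworkFacts.outdeg≢0 N (LooseLadder.P2-e₂ L))
...   | c , p₂c with NetworkFacts.leaf-below N tc c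
...     | z , c⇝z = ⊥-elim (separations-incompatible T-tree emb emb′
                      (Ladder.separates-via-e₂ L T-tree p₂c c⇝z emb e₂ (not-¬ e₁))
                      (Ladder.separates-via-f L T-tree p₂c c⇝z emb′ f₁ f₂))
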